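{- In a finite ordinal monoid $M$, every element $x$ such that $x\mathrel{\mathcal R}x^\omega$ is idempotent, i.e. $x\cdot x=x$.
   Context: An ordinal monoid is $(M,\pi)$ with $\pi$ a generalised product on countable ordinal words over $M$ ($\pi(x)=x$ on one-letter words and generalised associativity); $x\cdot y=\pi(xy)$ and $x^\omega=\pi(xxx\cdots)$ (the $\omega$-fold repetition). Green's relation $\mathcal R$ on the monoid $(M,\cdot)$: $x\leqslant_{\mathcal R}y$ iff $x=y\cdot b$ for some $b\in M$, and $x\mathrel{\mathcal R}y$ iff $x\leqslant_{\mathcal R}y$ and $y\leqslant_{\mathcal R}x$. -}

module Defs where

open import Level using (_⊔_) renaming (suc to lsuc; zero to lzero)
open import Data.Nat using (ℕ)
import Data.Nat.Properties as ℕP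
import Data.Nat.Induction as ℕI
open import Data.Fin using (Fin; toℕ; zero; suc)
import Data.Fin as F
import Data.Fin.Properties as FP
import Data.Fin.Induction as FI
open import Data.Product using (Σ; Σ-syntax; ∃; _×_; _,_; proj₁; proj₂)
open import Data.Sum using (_⊎_)
open import Relation.Binary.PropositionalEquality using (_≡_; subst)
open import Relation.Binary.Structures using (IsStrictTotalOrder)
open import Induction.WellFounded using (WellFounded)
open import Function.Definitions using (Injective)
open import Function.Bundles using (_↔_; _⇔_; Inverse)

-- A word of countable ordinal length over A: a countable strict well-order
-- (positions, strictly totally ordered, well-founded, injected into ℕ)
-- labelled by letters of A.
record OrdWord {a} (A : Set a) : Set (lsuc lzero ⊔ a) where
  field
    Pos      : Set
    _<_      : Pos → Pos → Set
    isSTO    : IsStrictTotalOrder _≡_ _<_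
    wf       : WellFounded _<_
    enum     : Pos → ℕ
    enum-inj : Injective _≡_ _≡_ enum
    label    : Pos → A

open OrdWord public

mapWord : ∀ {a b} {A : Set a} {B : Set b} → (A → B) → OrdWord A → OrdWord B
mapWord f w = record
  { Pos = Pos w ; _<_ = _<_ w ; isSTO = isSTO w ; wf = wf w
  ; enum = enum w ; enum-inj = enum-inj w ; label = λ i → f (label w i) }

-- isomorphism of words: order isomorphism of positions preserving labels
-- (words over ordinals are only determined up to such isomorphism)
record WordIso {a} {A : Set a} (w w' : OrdWord A) : Set a where
  field
    iso  : Pos w ↔ Pos w'
    mono : ∀ i j → _<_ w i j ⇔ _<_ w' (Inverse.to iso i) (Inverse.to iso j)
    lab  : ∀ i → label w' (Inverse.to iso i) ≡ label w i

LexΣ : ∀ {a} {A : Set a} (u : OrdWord (OrdWord A)) →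
       Σ (Pos u) (λ i → Pos (label u i)) → Σ (Pos u) (λ i → Pos (label u i)) → Set
LexΣ u (i , j) (i' , j') =
  _<_ u i i' ⊎ Σ (i ≡ i') (λ e → _<_ (label u i') (subst (λ x → Pos (label u x)) e j) j')

record IsConcat {a} {A : Set a} (w : OrdWord A) (u : OrdWord (OrdWord A)) : Set a where
  field
    iso  : Pos w ↔ Σ (Pos u) (λ i → Pos (label u i))
    mono : ∀ k k' → _<_ w k k' ⇔ LexΣ u (Inverse.to iso k) (Inverse.to iso k')
    lab  : ∀ k → label w k ≡ label (label u (proj₁ (Inverse.to iso k))) (proj₂ (Inverse.to iso k))

finWord : ∀ {a} {A : Set a} (n : ℕ) → (Fin n → A) → OrdWord A
finWord n f = record
  { Pos = Fin n ; _<_ = F._<_ ; isSTO = FP.<-isStrictTotalOrder ; wf = FI.<-wellFounded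
  ; enum = toℕ ; enum-inj = FP.toℕ-injective ; label = f }

omegaWord : ∀ {a} {A : Set a} → A → OrdWord A
omegaWord x = record
  { Pos = ℕ ; _<_ = Data.Nat._<_ ; isSTO = ℕP.<-isStrictTotalOrder ; wf = ℕI.<-wellFounded
  ; enum = λ n → n ; enum-inj = λ e → e ; label = λ _ → x }
  where import Data.Nat

oneWord : ∀ {a} {A : Set a} → A → OrdWord A
oneWord x = finWord 1 (λ _ → x)

twoWord : ∀ {a} {A : Set a} → A → A → OrdWord A
twoWord x y = finWord 2 (λ { zero → x ; (suc _) → y })

record OrdinalMonoid (M : Set) : Set₁ where
  field
    π       : OrdWord M → M
    π-iso   : ∀ {w w'} → WordIso w w' → π w ≡ π w'
    π-one   : ∀ x → π (oneWord x) ≡ x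
    π-assoc : ∀ (w : OrdWord M) (u : OrdWord (OrdWord M)) →
              IsConcat w u → π w ≡ π (mapWord π u)

  _·_ : M → M → M
  x · y = π (twoWord x y)

  _^ω : M → M
  x ^ω = π (omegaWord x)

  _≤R_ : M → M → Set
  x ≤R y = Σ M (λ b → x ≡ y · b)

  _R_ : M → M → Set
  x R y = x ≤R y × y ≤R x

IsFinite : Set → Set
IsFinite M = Σ ℕ (λ n → M ↔ Fin n)

{-# OPTIONS --safe #-}
module Submission where

open import Defs
open import Relation.Binary.PropositionalEquality using (_≡_; refl; sym; cong; module ≡-Reasoning)
open import Data.Nat using (ℕ; zero; suc; s≤s; z≤n)
open import Data.Fin using (Fin; zero; suc)
open import Data.Product using (Σ; _,_)
open import Data.Sum using (inj₁; inj₂)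
open import Function.Bundles using (mk↔ₛ′; mk⇔)
open import Function using (id)

-- If x = x^ω · b, then x · x = (x · x^ω) · b = x^ω · b = x, because the ω-word x x x ⋯
-- is the letter x followed by a copy of itself.

ConcatPos : ∀ {ℓ} {A : Set ℓ} → OrdWord (OrdWord A) → Set
ConcatPos u = Σ (Pos u) (λ i → Pos (label u i))

module _ {ℓ} {A : Set ℓ} (a b c : A) where

  threeWord : OrdWord A
  threeWord = finWord 3 λ { zero → a ; (suc zero) → b ; (suc (suc zero)) → c }

  private
    splitL : OrdWord (OrdWord A)
    splitL = twoWord (twoWord a b) (oneWord c)

    toL : Fin 3 → ConcatPos splitL
    toL zero             = zero , zero
    toL (suc zero)       = zero , suc zero
    toL (suc (suc zero)) = suc zero , zero

    fromL : ConcatPos splitL → Fin 3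
    fromL (zero , zero)     = zero
    fromL (zero , suc zero) = suc zero
    fromL (suc zero , zero) = suc (suc zero)

    toL-mono : ∀ k k' → _<_ threeWord k k' → LexΣ splitL (toL k) (toL k')
    toL-mono zero             (suc zero)       _                   = inj₂ (refl , s≤s z≤n)
    toL-mono zero             (suc (suc zero)) _                   = inj₁ (s≤s z≤n)
    toL-mono (suc zero)       (suc (suc zero)) _                   = inj₁ (s≤s z≤n)
    toL-mono zero             zero             ()
    toL-mono (suc zero)       zero             ()
    toL-mono (suc zero)       (suc zero)       (s≤s ())
    toL-mono (suc (suc zero)) zero             ()
    toL-mono (suc (suc zero)) (suc zero)       (s≤s ())
    toL-mono (suc (suc zero)) (suc (suc zero)) (s≤s (s≤s ()))

    toL-reflects : ∀ k k' → LexΣ splitL (toL k) (toL k') → _<_ threeWord k k'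
    toL-reflects zero             (suc zero)       _                  = s≤s z≤n
    toL-reflects zero             (suc (suc zero)) _                  = s≤s z≤n
    toL-reflects (suc zero)       (suc (suc zero)) _                  = s≤s (s≤s z≤n)
    toL-reflects zero             zero             (inj₁ ())
    toL-reflects zero             zero             (inj₂ (refl , ()))
    toL-reflects (suc zero)       zero             (inj₁ ())
    toL-reflects (suc zero)       zero             (inj₂ (refl , ()))
    toL-reflects (suc zero)       (suc zero)       (inj₁ ())
    toL-reflects (suc zero)       (suc zero)       (inj₂ (refl , s≤s ()))
    toL-reflects (suc (suc zero)) zero             (inj₁ ())
    toL-reflects (suc (suc zero)) zero             (inj₂ (() , _))
    toL-reflects (suc (suc zero)) (suc zero)       (inj₁ ())
    toL-reflects (suc (suc zero)) (suc zero)       (inj₂ (() , _))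
    toL-reflects (suc (suc zero)) (suc (suc zero)) (inj₁ (s≤s ()))
    toL-reflects (suc (suc zero)) (suc (suc zero)) (inj₂ (refl , ()))

    splitR : OrdWord (OrdWord A)
    splitR = twoWord (oneWord a) (twoWord b c)

    toR : Fin 3 → ConcatPos splitR
    toR zero             = zero , zero
    toR (suc zero)       = suc zero , zero
    toR (suc (suc zero)) = suc zero , suc zero

    fromR : ConcatPos splitR → Fin 3
    fromR (zero , zero)         = zero
    fromR (suc zero , zero)     = suc zero
    fromR (suc zero , suc zero) = suc (suc zero)

    toR-mono : ∀ k k' → _<_ threeWord k k' → LexΣ splitR (toR k) (toR k')
    toR-mono zero             (suc zero)       _                   = inj₁ (s≤s z≤n)
    toR-mono zero             (suc (suc zero)) _                   = inj₁ (s≤s z≤n)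
    toR-mono (suc zero)       (suc (suc zero)) _                   = inj₂ (refl , s≤s z≤n)
    toR-mono zero             zero             ()
    toR-mono (suc zero)       zero             ()
    toR-mono (suc zero)       (suc zero)       (s≤s ())
    toR-mono (suc (suc zero)) zero             ()
    toR-mono (suc (suc zero)) (suc zero)       (s≤s ())
    toR-mono (suc (suc zero)) (suc (suc zero)) (s≤s (s≤s ()))

    toR-reflects : ∀ k k' → LexΣ splitR (toR k) (toR k') → _<_ threeWord k k'
    toR-reflects zero             (suc zero)       _                  = s≤s z≤n
    toR-reflects zero             (suc (suc zero)) _                  = s≤s z≤n
    toR-reflects (suc zero)       (suc (suc zero)) _                  = s≤s (s≤s z≤n)
    toR-reflects zero             zero             (inj₁ ())
    toR-reflects zero             zero             (inj₂ (refl , ()))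
    toR-reflects (suc zero)       zero             (inj₁ ())
    toR-reflects (suc zero)       zero             (inj₂ (() , _))
    toR-reflects (suc zero)       (suc zero)       (inj₁ (s≤s ()))
    toR-reflects (suc zero)       (suc zero)       (inj₂ (refl , ()))
    toR-reflects (suc (suc zero)) zero             (inj₁ ())
    toR-reflects (suc (suc zero)) zero             (inj₂ (() , _))
    toR-reflects (suc (suc zero)) (suc zero)       (inj₁ (s≤s ()))
    toR-reflects (suc (suc zero)) (suc zero)       (inj₂ (refl , ()))
    toR-reflects (suc (suc zero)) (suc (suc zero)) (inj₁ (s≤s ()))
    toR-reflects (suc (suc zero)) (suc (suc zero)) (inj₂ (refl , s≤s ()))

  threeWord-concat-ab-c : IsConcat threeWord (twoWord (twoWord a b) (oneWord c))
  threeWord-concat-ab-c = record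
    { iso  = mk↔ₛ′ toL fromL
               (λ { (zero , zero) → refl ; (zero , suc zero) → refl ; (suc zero , zero) → refl })
               (λ { zero → refl ; (suc zero) → refl ; (suc (suc zero)) → refl })
    ; mono = λ k k' → mk⇔ (toL-mono k k') (toL-reflects k k')
    ; lab  = λ { zero → refl ; (suc zero) → refl ; (suc (suc zero)) → refl } }

  threeWord-concat-a-bc : IsConcat threeWord (twoWord (oneWord a) (twoWord b c))
  threeWord-concat-a-bc = record
    { iso  = mk↔ₛ′ toR fromR
               (λ { (zero , zero) → refl ; (suc zero , zero) → refl ; (suc zero , suc zero) → refl })
               (λ { zero → refl ; (suc zero) → refl ; (suc (suc zero)) → refl })
    ; mono = λ k k' → mk⇔ (toR-mono k k') (toR-reflects k k')
    ; lab  = λ { zero → refl ; (suc zero) → refl ; (suc (suc zero)) → refl } }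

module _ {ℓ} {A : Set ℓ} (x : A) where

  private
    splitω : OrdWord (OrdWord A)
    splitω = twoWord (oneWord x) (omegaWord x)

    toω : ℕ → ConcatPos splitω
    toω zero    = zero , zero
    toω (suc n) = suc zero , n

    fromω : ConcatPos splitω → ℕ
    fromω (zero , zero)  = zero
    fromω (suc zero , n) = suc n

    toω-mono : ∀ k k' → _<_ (omegaWord x) k k' → LexΣ splitω (toω k) (toω k')
    toω-mono zero    (suc m) _       = inj₁ (s≤s z≤n)
    toω-mono (suc n) (suc m) (s≤s p) = inj₂ (refl , p)

    toω-reflects : ∀ k k' → LexΣ splitω (toω k) (toω k') → _<_ (omegaWord x) k k'
    toω-reflects zero    (suc m) _                  = s≤s z≤n
    toω-reflects (suc n) (suc m) (inj₂ (refl , p))  = s≤s p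
    toω-reflects zero    zero    (inj₁ ())
    toω-reflects zero    zero    (inj₂ (refl , ()))
    toω-reflects (suc n) zero    (inj₁ ())
    toω-reflects (suc n) zero    (inj₂ (() , _))
    toω-reflects (suc n) (suc m) (inj₁ (s≤s ()))

  omegaWord-concat-x-ω : IsConcat (omegaWord x) (twoWord (oneWord x) (omegaWord x))
  omegaWord-concat-x-ω = record
    { iso  = mk↔ₛ′ toω fromω (λ { (zero , zero) → refl ; (suc zero , n) → refl })
                             (λ { zero → refl ; (suc n) → refl })
    ; mono = λ k k' → mk⇔ (toω-mono k k') (toω-reflects k k')
    ; lab  = λ { zero → refl ; (suc n) → refl } }

module _ {M : Set} (O : OrdinalMonoid M) where
  open OrdinalMonoid O
  open ≡-Reasoning

  π-finWord-cong : ∀ n {f g : Fin n → M} → (∀ i → f i ≡ g i) → π (finWord n f) ≡ π (finWord n g)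
  π-finWord-cong n f≗g = π-iso record
    { iso  = mk↔ₛ′ id id (λ _ → refl) (λ _ → refl)
    ; mono = λ _ _ → mk⇔ id id
    ; lab  = λ i → sym (f≗g i) }

  π-concat₂ : ∀ {w u v} → IsConcat w (twoWord u v) → π w ≡ π u · π v
  π-concat₂ {w} {u} {v} w=uv = begin
    π w                           ≡⟨ π-assoc w (twoWord u v) w=uv ⟩
    π (mapWord π (twoWord u v))   ≡⟨ π-finWord-cong 2 (λ { zero → refl ; (suc zero) → refl }) ⟩
    π u · π v                     ∎

  ·-assoc : ∀ a b c → (a · b) · c ≡ a · (b · c)
  ·-assoc a b c = begin
    (a · b) · c               ≡⟨ cong ((a · b) ·_) (π-one c) ⟨
    (a · b) · π (oneWord c)   ≡⟨ π-concat₂ (threeWord-concat-ab-c a b c) ⟨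
    π (threeWord a b c)       ≡⟨ π-concat₂ (threeWord-concat-a-bc a b c) ⟩
    π (oneWord a) · (b · c)   ≡⟨ cong (_· (b · c)) (π-one a) ⟩
    a · (b · c)               ∎

  ·-^ω-absorbˡ : ∀ x → x · (x ^ω) ≡ x ^ω
  ·-^ω-absorbˡ x = begin
    x · (x ^ω)               ≡⟨ cong (_· (x ^ω)) (π-one x) ⟨
    π (oneWord x) · (x ^ω)   ≡⟨ π-concat₂ (omegaWord-concat-x-ω x) ⟨
    x ^ω                     ∎

  ≤R-^ω⇒idempotent : ∀ x → x ≤R (x ^ω) → x · x ≡ x
  ≤R-^ω⇒idempotent x (b , x≡xωb) = begin
    x · x                    ≡⟨ cong (x ·_) x≡xωb ⟩
    x · ((x ^ω) · b)         ≡⟨ ·-assoc x (x ^ω) b ⟨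
    (x · (x ^ω)) · b         ≡⟨ cong (_· b) (·-^ω-absorbˡ x) ⟩
    (x ^ω) · b               ≡⟨ x≡xωb ⟨
    x                        ∎

mainTheorem18 : (M : Set) (O : OrdinalMonoid M) → IsFinite M →
                let open OrdinalMonoid O in
                (x : M) → x R (x ^ω) → x · x ≡ x
mainTheorem18 M O _ x (x≤Rxω , _) = ≤R-^ω⇒idempotent O x x≤Rxω
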